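{- Let $\ell\ge 1$ and $n$ be integers, and let $T$ be an $n$-vertex tree for which $k(T)$ is defined. Then $k(T)$ is determined by the $(n-\ell)$-deck of $T$: every $n$-vertex tree $T'$ having the same $(n-\ell)$-deck as $T$ has $k(T')$ defined and $k(T')=k(T)$.
   Context: The $(n-\ell)$-deck of an $n$-vertex graph is the multiset of its (unlabeled) induced subgraphs on $n-\ell$ vertices (cards). A $j$-evine is a tree of diameter $2j+1$. For an $n$-vertex tree $T$ (and fixed $\ell$), $k(T)$ is the largest integer $j\ge0$ such that $T$ contains a subtree that is a $j$-evine and every subtree of $T$ that is a $j$-evine has fewer than $n-\ell$ vertices; $k(T)$ is defined when such a $j$ exists (e.g. when $T$ has an edge and $n-\ell\ge3$, since edges are the $0$-evines). -}

module Defs where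

open import Data.Nat using (ℕ; zero; suc; _+_; _∸_; _≤_; _<_)
open import Data.Fin using (Fin; zero; suc; inject₁; fromℕ)
open import Data.Fin.Subset using (Subset; _∈_; ∣_∣; ⊤)
open import Data.Bool using (Bool; true; false)
open import Data.Product using (Σ; ∃; _×_; _,_; proj₁)
open import Relation.Nullary using (¬_)
open import Relation.Binary.PropositionalEquality using (_≡_)
open import Function.Bundles using (_↔_; Inverse)
open import Function.Definitions using (Injective)

record Graph (n : ℕ) : Set where
  field
    adj    : Fin n → Fin n → Bool
    symm   : ∀ u v → adj u v ≡ adj v u
    irrefl : ∀ u → adj u u ≡ false

open Graph public

module _ {n : ℕ} (G : Graph n) where

  data Walk (S : Subset n) : Fin n → Fin n → ℕ → Set where
    here : ∀ {u} → u ∈ S → Walk S u u 0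
    step : ∀ {u v w k} → u ∈ S → adj G u v ≡ true → Walk S v w k → Walk S u w (suc k)

  Connected : Subset n → Set
  Connected S = ∀ u v → u ∈ S → v ∈ S → ∃ λ k → Walk S u v k

  -- A cycle in G[S]: distinct vertices c 0, …, c (k+2) (at least 3),
  -- consecutive ones adjacent and the last adjacent to the first.
  record Cycle (S : Subset n) : Set where
    field
      len    : ℕ
      c      : Fin (suc (suc (suc len))) → Fin n
      inj    : Injective _≡_ _≡_ c
      inS    : ∀ i → c i ∈ S
      consec : ∀ (i : Fin (suc (suc len))) → adj G (c (inject₁ i)) (c (suc i)) ≡ true
      close  : adj G (c (fromℕ (suc (suc len)))) (c zero) ≡ true

  Acyclic : Subset n → Set
  Acyclic S = ¬ Cycle S

  IsTreeOn : Subset n → Set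
  IsTreeOn S = Connected S × Acyclic S

  Dist : Subset n → Fin n → Fin n → ℕ → Set
  Dist S u v d = Walk S u v d × (∀ k → k < d → ¬ Walk S u v k)

  Diameter : Subset n → ℕ → Set
  Diameter S d =
    (∃ λ u → ∃ λ v → u ∈ S × v ∈ S × Dist S u v d)
    × (∀ u v → u ∈ S → v ∈ S → ∃ λ k → k ≤ d × Walk S u v k)

  IsEvine : ℕ → Subset n → Set
  IsEvine j S = IsTreeOn S × Diameter S (suc (j + j))

IsTree : ∀ {n} → Graph n → Set
IsTree {n} G = IsTreeOn G ⊤

Vtx : ∀ {n} → Subset n → Set
Vtx {n} S = Σ (Fin n) (λ v → v ∈ S)

InducedIso : ∀ {n} → Graph n → Subset n → Graph n → Subset n → Set
InducedIso G S H S' =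
  Σ (Vtx S ↔ Vtx S') λ f →
    ∀ u v → adj G (proj₁ u) (proj₁ v) ≡ adj H (proj₁ (Inverse.to f u)) (proj₁ (Inverse.to f v))

CardIdx : ℕ → ℕ → Set
CardIdx n m = Σ (Subset n) (λ S → ∣ S ∣ ≡ m)

-- G and H have the same m-deck: the multisets of isomorphism classes of
-- induced subgraphs on m vertices agree, i.e. there is a bijection between
-- the m-subsets of V(G) and of V(H) matching isomorphic cards.
SameDeck : ∀ {n} → ℕ → Graph n → Graph n → Set
SameDeck {n} m G H =
  Σ (CardIdx n m ↔ CardIdx n m) λ φ →
    ∀ c → InducedIso G (proj₁ c) H (proj₁ (Inverse.to φ c))

-- The property of j in the definition of k(T) (for fixed ℓ): T has a j-evine
-- subtree, and every j-evine subtree has fewer than n - ℓ vertices.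
KCand : ∀ {n} → ℕ → Graph n → ℕ → Set
KCand {n} ℓ T j =
  (∃ λ S → IsEvine T j S) × (∀ S → IsEvine T j S → ∣ S ∣ < n ∸ ℓ)

IsK : ∀ {n} → ℕ → Graph n → ℕ → Set
IsK ℓ T j = KCand ℓ T j × (∀ j' → KCand ℓ T j' → j' ≤ j)

module Submission where

-- A j-evine S of T with fewer than n - ℓ vertices lies inside some card of T; the isomorphic card
-- of T′ contains an isomorphic copy of S, so T′ has a j-evine as well. Conversely, a j-evine of T′
-- with at least n - ℓ vertices can be shrunk to one with exactly n - ℓ vertices by repeatedly
-- deleting a leaf that is off a diametral path, which keeps it a tree of the same diameter. That
-- evine is a whole card, so T would have a j-evine with n - ℓ vertices too. Hence the j with the
-- defining property of k are the same for T and T′.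

open import Data.Bool using (true; if_then_else_)
import Data.Bool.Properties as Bool
open import Data.Fin using (Fin; zero; suc; inject₁; fromℕ)
open import Data.Fin.Properties using (_≟_; any?)
open import Data.Fin.Subset using (Subset; _∈_; _⊆_; ∣_∣; _-_; ⊤; inside; outside)
open import Data.Fin.Subset.Properties
  using (_∈?_; ∈⊤; ⊆⊤; ∣⊤∣≡n; ∣⊥∣≡0; Empty-unique; p⊆q⇒∣p∣≤∣q∣; p─⊥≡p; p─q⊆p;
         x∈p∧x≢y⇒x∈p-y; x∈p⇒∣p-x∣<∣p∣)
open import Data.Nat using (ℕ; zero; suc; _+_; _∸_; _≤_; _<_; z≤n; s≤s)
open import Data.Nat.Properties
  using (≤-refl; ≤-trans; ≤-reflexive; ≤-antisym; n≤1+n; m≤n⇒m≤1+n; 1+n≰n; <⇒≤; <⇒≱; ≰⇒>; ≮⇒≥;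
         <-irrefl; _≤?_; _<?_; +-identityʳ; +-suc; m≤n+m; m∸n≤m; m∸n+n≡m; suc-injective)
open import Data.Product using (Σ; ∃; _×_; _,_; proj₁; proj₂)
open import Data.Sum using (_⊎_; inj₁; inj₂)
open import Data.Vec using (Vec; []; _∷_; here; there; lookup; tabulate)
open import Data.Vec.Properties using (lookup∘tabulate; []=⇒lookup; lookup⇒[]=)
open import Data.Vec.Relation.Unary.All as All using (All; []; _∷_)
open import Data.Vec.Relation.Unary.Any using (here; there)
open import Data.Vec.Membership.Propositional using () renaming (_∈_ to _∈ᵥ_; _∉_ to _∉ᵥ_)
open import Data.Vec.Membership.Propositional.Properties using (∈-lookup)
import Data.Vec.Membership.DecPropositional as DecMembership
open import Data.Vec.Relation.Unary.Unique.Propositional using (Unique; []; _∷_)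
open import Data.Vec.Relation.Unary.Unique.Propositional.Properties using (lookup-injective)
open import Function using (_∘_; case_of_)
open import Function.Bundles using (Inverse)
open import Level using (0ℓ)
open import Relation.Nullary using (¬_; Dec; yes; no; does; contradiction)
open import Relation.Nullary.Decidable using (dec-true; decidable-stable; _×-dec_; ¬?)
open import Relation.Unary using (Pred; Decidable)
open import Relation.Binary.PropositionalEquality
open ≡-Reasoning

open import Defs

∈-irrelevant : ∀ {n} {x : Fin n} {p : Subset n} (i j : x ∈ p) → i ≡ j
∈-irrelevant here      here      = refl
∈-irrelevant (there i) (there j) = cong there (∈-irrelevant i j)

x∈p-y⇒x≢y : ∀ {n} {x y : Fin n} {p : Subset n} → x ∈ p - y → x ≢ y
x∈p-y⇒x≢y {y = zero}  {_ ∷ _} (there _)   ()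
x∈p-y⇒x≢y {y = suc y} {_ ∷ _} here        ()
x∈p-y⇒x≢y {y = suc y} {_ ∷ _} (there x∈p) refl = x∈p-y⇒x≢y x∈p refl

∣p∣≡1+∣p-x∣ : ∀ {n} {x : Fin n} {p : Subset n} → x ∈ p → ∣ p ∣ ≡ suc ∣ p - x ∣
∣p∣≡1+∣p-x∣ {p = inside ∷ p}  here        = cong (λ q → suc ∣ q ∣) (sym (p─⊥≡p p))
∣p∣≡1+∣p-x∣ {p = inside ∷ _}  (there x∈p) = cong suc (∣p∣≡1+∣p-x∣ x∈p)
∣p∣≡1+∣p-x∣ {p = outside ∷ _} (there x∈p) = ∣p∣≡1+∣p-x∣ x∈p

∣p∣≤1+∣p-x∣ : ∀ {n} (x : Fin n) (p : Subset n) → ∣ p ∣ ≤ suc ∣ p - x ∣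
∣p∣≤1+∣p-x∣ x p with x ∈? p
... | yes x∈p = ≤-reflexive (∣p∣≡1+∣p-x∣ x∈p)
... | no  x∉p = m≤n⇒m≤1+n (p⊆q⇒∣p∣≤∣q∣ {p = p} {q = p - x}
                             λ y∈p → x∈p∧x≢y⇒x∈p-y y∈p λ { refl → x∉p y∈p })

⊆-extend : ∀ {n m} (p : Subset n) → ∣ p ∣ ≤ m → m ≤ n → ∃ λ q → p ⊆ q × ∣ q ∣ ≡ m
⊆-extend {m = zero} [] _ _ = [] , (λ ()) , refl
⊆-extend {m = suc m} (inside ∷ p) (s≤s ∣p∣≤m) (s≤s m≤n) =
  let q , p⊆q , ∣q∣≡m = ⊆-extend p ∣p∣≤m m≤n
  in inside ∷ q , (λ { here → here ; (there x∈p) → there (p⊆q x∈p) }) , cong suc ∣q∣≡m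
⊆-extend {n = suc n} {m} (outside ∷ p) ∣p∣≤m m≤1+n with m ≤? n
... | yes m≤n = let q , p⊆q , ∣q∣≡m = ⊆-extend p ∣p∣≤m m≤n
                in outside ∷ q , (λ { (there x∈p) → there (p⊆q x∈p) }) , ∣q∣≡m
... | no  m≰n = ⊤ , ⊆⊤ , trans (∣⊤∣≡n (suc n)) (≤-antisym (≰⇒> m≰n) m≤1+n)

module _ {n} {P : Pred (Fin n) 0ℓ} (P? : Decidable P) where

  filter : Subset n
  filter = tabulate λ x → if does (P? x) then inside else outside

  ∈-filter⁺ : ∀ {x} → P x → x ∈ filter
  ∈-filter⁺ {x} Px = lookup⇒[]= x filter
    (trans (lookup∘tabulate _ x) (cong (if_then inside else outside) (dec-true (P? x) Px)))

  ∈-filter⁻ : ∀ {x} → x ∈ filter → P x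
  ∈-filter⁻ {x} x∈ with P? x | trans (sym (lookup∘tabulate _ x)) ([]=⇒lookup x∈)
  ... | yes Px | _  = Px
  ... | no  _  | ()

_∈ᵥ?_ : ∀ {n L} (x : Fin n) (xs : Vec (Fin n) L) → Dec (x ∈ᵥ xs)
x ∈ᵥ? xs = DecMembership._∈?_ _≟_ x xs

All-∈ : ∀ {A : Set} {P : Pred A 0ℓ} {L} {xs : Vec A L} → (∀ {x} → x ∈ᵥ xs → P x) → All P xs
All-∈ {xs = []}     _   = []
All-∈ {xs = x ∷ xs} ∈⇒P = ∈⇒P (here refl) ∷ All-∈ (∈⇒P ∘ there)

∉⇒All≢ : ∀ {A : Set} {L} {x : A} {xs : Vec A L} → x ∉ᵥ xs → All (x ≢_) xs
∉⇒All≢ x∉xs = All-∈ λ { y∈xs refl → x∉xs y∈xs }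

∣p∣≤length : ∀ {n L} (xs : Vec (Fin n) L) (p : Subset n) → (∀ {x} → x ∈ p → x ∈ᵥ xs) → ∣ p ∣ ≤ L
∣p∣≤length {n} [] p p⊆xs =
  ≤-reflexive (trans (cong ∣_∣ (Empty-unique {p = p} λ (_ , x∈p) → case p⊆xs x∈p of λ ())) (∣⊥∣≡0 n))
∣p∣≤length (x ∷ xs) p p⊆xs = ≤-trans (∣p∣≤1+∣p-x∣ x p) (s≤s (∣p∣≤length xs (p - x) p-x⊆xs))
  where
  p-x⊆xs : ∀ {y} → y ∈ p - x → y ∈ᵥ xs
  p-x⊆xs y∈ with p⊆xs (p─q⊆p p _ y∈)
  ... | here refl  = contradiction refl (x∈p-y⇒x≢y y∈)
  ... | there y∈xs = y∈xs

length≤∣p∣ : ∀ {n L} {xs : Vec (Fin n) L} {p : Subset n} → Unique xs → (∀ {x} → x ∈ᵥ xs → x ∈ p) →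
             L ≤ ∣ p ∣
length≤∣p∣ [] _ = z≤n
length≤∣p∣ {xs = x ∷ xs} {p} (x∉xs ∷ uniq) xs⊆p =
  ≤-trans (s≤s (length≤∣p∣ uniq xs⊆p-x)) (x∈p⇒∣p-x∣<∣p∣ (xs⊆p (here refl)))
  where
  xs⊆p-x : ∀ {y} → y ∈ᵥ xs → y ∈ p - x
  xs⊆p-x y∈xs = x∈p∧x≢y⇒x∈p-y (xs⊆p (there y∈xs)) (≢-sym (All.lookup x∉xs y∈xs))

module Walks {n : ℕ} (G : Graph n) where

  infix 4 _~_
  _~_ : Fin n → Fin n → Set
  u ~ v = adj G u v ≡ true

  private variable
    S S′ : Subset n
    a b c u v w z : Fin n
    k l : ℕ

  _~?_ : ∀ u v → Dec (u ~ v)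
  u ~? v = adj G u v Bool.≟ true

  ~-sym : u ~ v → v ~ u
  ~-sym {u} {v} e = trans (symm G v u) e

  ~-irrefl : ¬ u ~ u
  ~-irrefl {u} e with () ← trans (sym e) (irrefl G u)

  Reachable : Subset n → Fin n → Fin n → Set
  Reachable S u v = ∃ λ k → Walk G S u v k

  vertices : Walk G S u v k → Vec (Fin n) (suc k)
  vertices (here {u} _)     = u ∷ []
  vertices (step {u} _ _ p) = u ∷ vertices p

  source∈ : Walk G S u v k → u ∈ S
  source∈ (here u∈)     = u∈
  source∈ (step u∈ _ _) = u∈

  vertices⊆ : (p : Walk G S u v k) → z ∈ᵥ vertices p → z ∈ S
  vertices⊆ (here u∈)     (here refl) = u∈
  vertices⊆ (step u∈ _ _) (here refl) = u∈
  vertices⊆ (step _ _ p)  (there z∈)  = vertices⊆ p z∈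

  source∈vertices : (p : Walk G S u v k) → u ∈ᵥ vertices p
  source∈vertices (here _)     = here refl
  source∈vertices (step _ _ _) = here refl

  target∈vertices : (p : Walk G S u v k) → v ∈ᵥ vertices p
  target∈vertices (here _)     = here refl
  target∈vertices (step _ _ p) = there (target∈vertices p)

  weaken : S ⊆ S′ → Walk G S u v k → Walk G S′ u v k
  weaken S⊆S′ (here u∈)     = here (S⊆S′ u∈)
  weaken S⊆S′ (step u∈ e p) = step (S⊆S′ u∈) e (weaken S⊆S′ p)

  vertices-weaken : (S⊆S′ : S ⊆ S′) (p : Walk G S u v k) → vertices (weaken S⊆S′ p) ≡ vertices p
  vertices-weaken S⊆S′ (here _)     = refl
  vertices-weaken S⊆S′ (step _ _ p) = cong (_ ∷_) (vertices-weaken S⊆S′ p)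

  restrict : (p : Walk G S u v k) → (∀ {z} → z ∈ᵥ vertices p → z ∈ S′) → Walk G S′ u v k
  restrict (here _)     ⊆S′ = here (⊆S′ (here refl))
  restrict (step _ e p) ⊆S′ = step (⊆S′ (here refl)) e (restrict p (⊆S′ ∘ there))

  vertices-restrict : (p : Walk G S u v k) (⊆S′ : ∀ {z} → z ∈ᵥ vertices p → z ∈ S′) →
                      vertices (restrict p ⊆S′) ≡ vertices p
  vertices-restrict (here _)     _   = refl
  vertices-restrict (step _ _ p) ⊆S′ = cong (_ ∷_) (vertices-restrict p (⊆S′ ∘ there))

  _++_ : Walk G S u v k → Walk G S v w l → Walk G S u w (k + l)
  here _      ++ q = q
  step u∈ e p ++ q = step u∈ e (p ++ q)

  reverse : Walk G S u v k → Reachable S v u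
  reverse p = go p (here (source∈ p))
    where
    go : Walk G S a v k → Walk G S a u l → Reachable S v u
    go (here _)     acc = _ , acc
    go (step _ e p) acc = go p (step (source∈ p) (~-sym e) acc)

  prefix : (p : Walk G S u v k) → z ∈ᵥ vertices p → Reachable S u z
  prefix (here u∈)     (here refl) = _ , here u∈
  prefix (step u∈ _ _) (here refl) = _ , here u∈
  prefix (step u∈ e p) (there z∈)  = let _ , q = prefix p z∈ in _ , step u∈ e q

  vertices-connected : (p : Walk G S u v k) → (∀ {z} → z ∈ᵥ vertices p → z ∈ S′) →
                       a ∈ᵥ vertices p → b ∈ᵥ vertices p → Reachable S′ a b
  vertices-connected p ⊆S′ a∈ b∈ =
    let _ , q   = prefix p′ (on-p′ a∈)
        _ , q⁻¹ = reverse q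
        _ , r   = prefix p′ (on-p′ b∈)
    in _ , q⁻¹ ++ r
    where
    p′ = restrict p ⊆S′
    on-p′ : ∀ {z} → z ∈ᵥ vertices p → z ∈ᵥ vertices p′
    on-p′ = subst (_ ∈ᵥ_) (sym (vertices-restrict p ⊆S′))

  Path : Subset n → Fin n → Fin n → Set
  Path S u v = ∃ λ k → Σ (Walk G S u v k) λ p → Unique (vertices p)

  suffix : (p : Walk G S u v k) → Unique (vertices p) → z ∈ᵥ vertices p → Path S z v
  suffix p@(here _)     uniq       (here refl) = _ , p , uniq
  suffix p@(step _ _ _) uniq       (here refl) = _ , p , uniq
  suffix (step _ _ p)   (_ ∷ uniq) (there z∈)  = suffix p uniq z∈

  toPath : Walk G S u v k → Path S u v
  toPath (here u∈) = _ , here u∈ , [] ∷ []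
  toPath {u = u} (step u∈ e p) with toPath p
  ... | _ , q , uniq with u ∈ᵥ? vertices q
  ...   | yes u∈q = suffix q uniq u∈q
  ...   | no  u∉q = _ , step u∈ e q , ∉⇒All≢ u∉q ∷ uniq

  lookup-vertices-source : (p : Walk G S u v k) → lookup (vertices p) zero ≡ u
  lookup-vertices-source (here _)     = refl
  lookup-vertices-source (step _ _ _) = refl

  lookup-vertices-target : (p : Walk G S u v k) → lookup (vertices p) (fromℕ k) ≡ v
  lookup-vertices-target (here _)     = refl
  lookup-vertices-target (step _ _ p) = lookup-vertices-target p

  lookup-vertices-step : (p : Walk G S u v k) (i : Fin k) →
                         lookup (vertices p) (inject₁ i) ~ lookup (vertices p) (suc i)
  lookup-vertices-step (step _ e p) zero    rewrite lookup-vertices-source p = e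
  lookup-vertices-step (step _ _ p) (suc i) = lookup-vertices-step p i

  path+edge⇒cycle : (p : Walk G S u v (suc (suc k))) → Unique (vertices p) → v ~ u → Cycle G S
  path+edge⇒cycle {k = k} p uniq v~u = record
    { len    = k
    ; c      = lookup (vertices p)
    ; inj    = lookup-injective uniq _ _
    ; inS    = λ i → vertices⊆ p (∈-lookup i (vertices p))
    ; consec = lookup-vertices-step p
    ; close  = subst₂ _~_ (sym (lookup-vertices-target p)) (sym (lookup-vertices-source p)) v~u
    }

  acyclic-⊆ : S ⊆ S′ → Acyclic G S′ → Acyclic G S
  acyclic-⊆ S⊆S′ acyclic cycle = acyclic record
    { Cycle cycle using (len; c; inj; consec; close) ; inS = S⊆S′ ∘ Cycle.inS cycle }

  acyclic⇒neighbours-separated : Acyclic G S → b ∈ S → b ~ a → b ~ c → a ≢ c →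
                                 ¬ Walk G (S - b) a c k
  acyclic⇒neighbours-separated {S} {b} acyclic b∈ b~a b~c a≢c p with toPath p
  ... | zero  , here _ , _    = a≢c refl
  ... | suc _ , q      , uniq = acyclic (path+edge⇒cycle (step b∈ b~a (weaken S-b⊆S q)) uniq′ (~-sym b~c))
    where
    S-b⊆S = p─q⊆p S _
    b∉q : All (b ≢_) (vertices q)
    b∉q = All-∈ λ z∈ → ≢-sym (x∈p-y⇒x≢y (vertices⊆ q z∈))
    uniq′ : Unique (b ∷ vertices (weaken S-b⊆S q))
    uniq′ = subst (Unique ∘ (b ∷_)) (sym (vertices-weaken S-b⊆S q)) (b∉q ∷ uniq)

  boundary-edge : {P : Pred (Fin n) 0ℓ} → Decidable P → Walk G S a b k → P a → ¬ P b →
                  ∃ λ r → ∃ λ s → P r × ¬ P s × s ∈ S × r ~ s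
  boundary-edge P? (here _) Pa ¬Pb = contradiction Pa ¬Pb
  boundary-edge P? (step {v = a′} _ e p) Pa ¬Pb with P? a′
  ... | yes Pa′ = boundary-edge P? p Pa′ ¬Pb
  ... | no ¬Pa′ = _ , a′ , Pa , ¬Pa′ , source∈ p , e

  AtMostOneNeighbour : Subset n → Fin n → Set
  AtMostOneNeighbour S x = ∃ λ p → ∀ {z} → z ∈ S → x ~ z → z ≡ p

  bypass : ∀ {x} → AtMostOneNeighbour S x → a ≢ x → b ≢ x → Walk G S a b k →
           ∃ λ k′ → k′ ≤ k × Walk G (S - x) a b k′
  bypass _ a≢x _ (here a∈) = 0 , z≤n , here (x∈p∧x≢y⇒x∈p-y a∈ a≢x)
  bypass {x = x} leaf a≢x b≢x (step {v = a′} a∈ e p) with a′ ≟ x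
  ... | no a′≢x = let k′ , k′≤ , q = bypass leaf a′≢x b≢x p
                  in suc k′ , s≤s k′≤ , step (x∈p∧x≢y⇒x∈p-y a∈ a≢x) e q
  bypass _ _ b≢x (step _ _ (here _)) | yes refl = contradiction refl b≢x
  -- a walk entering x must leave it again through its only neighbour, so both steps can be cut
  bypass {S} (p , unique) a≢x b≢x (step a∈ a~x (step _ x~a″ q)) | yes refl =
    let a″≡a = trans (unique (source∈ q) x~a″) (sym (unique a∈ (~-sym a~x)))
        k′ , k′≤ , r = bypass (p , unique) (λ a″≡x → a≢x (trans (sym a″≡a) a″≡x)) b≢x q
    in k′ , m≤n⇒m≤1+n (m≤n⇒m≤1+n k′≤) , subst (λ s → Walk G (S - _) s _ k′) a″≡a r

  Dist-⊆ : ∀ {d} → S ⊆ S′ → Walk G S u v d → Dist G S′ u v d → Dist G S u v d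
  Dist-⊆ S⊆S′ p (_ , minimal) = p , λ k k<d q → minimal k k<d (weaken S⊆S′ q)

  Dist⇒d<∣S∣ : ∀ {d} → Dist G S u v d → d < ∣ S ∣
  Dist⇒d<∣S∣ {d = d} (p , minimal) with toPath p
  ... | k , q , uniq with d ≤? k
  ...   | yes d≤k = ≤-trans (s≤s d≤k) (length≤∣p∣ uniq (vertices⊆ q))
  ...   | no  d≰k = contradiction q (minimal k (≰⇒> d≰k))

module LeafSearch {n} {G : Graph n} {A : Subset n} (tree : IsTreeOn G A) {s t d} (P : Walk G A s t d)
  where

  open Walks G

  LeafOffP : Set
  LeafOffP = ∃ λ y → y ∈ A × y ∉ᵥ vertices P × AtMostOneNeighbour A y

  -- R runs from its end y back to r₀ on P. Once every neighbour of y lies on R or on P, all of them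
  -- are joined to the next vertex p of R by a walk avoiding y, so acyclicity leaves only p.
  stuck⇒leaf : ∀ {y r₀ l} → r₀ ∈ᵥ vertices P → (R : Walk G A y r₀ (suc l)) → Unique (vertices R) →
               y ∉ᵥ vertices P → (∀ {z} → z ∈ A → y ~ z → z ∈ᵥ vertices R ⊎ z ∈ᵥ vertices P) →
               AtMostOneNeighbour A y
  stuck⇒leaf {y} r₀∈P (step {v = p} y∈ y~p R) (y∉R ∷ _) y∉P covered = p , only-p
    where
    R-avoids-y : ∀ {z} → z ∈ᵥ vertices R → z ∈ A - y
    R-avoids-y z∈R = x∈p∧x≢y⇒x∈p-y (vertices⊆ R z∈R) (≢-sym (All.lookup y∉R z∈R))

    P-avoids-y : ∀ {z} → z ∈ᵥ vertices P → z ∈ A - y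
    P-avoids-y z∈P = x∈p∧x≢y⇒x∈p-y (vertices⊆ P z∈P) λ { refl → y∉P z∈P }

    reach : ∀ {z} → z ∈ᵥ vertices (step y∈ y~p R) ⊎ z ∈ᵥ vertices P → z ≢ y → Reachable (A - y) p z
    reach (inj₁ (here refl)) z≢y = contradiction refl z≢y
    reach (inj₁ (there z∈R)) _   = vertices-connected R R-avoids-y (source∈vertices R) z∈R
    reach (inj₂ z∈P)         _   =
      let _ , q = vertices-connected R R-avoids-y (source∈vertices R) (target∈vertices R)
          _ , r = vertices-connected P P-avoids-y r₀∈P z∈P
      in _ , q ++ r

    only-p : ∀ {z} → z ∈ A → y ~ z → z ≡ p
    only-p {z} z∈ y~z with z ≟ p
    ... | yes z≡p = z≡p
    ... | no  z≢p = contradiction (proj₂ (reach (covered z∈ y~z) λ { refl → ~-irrefl y~z }))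
                      (acyclic⇒neighbours-separated (proj₂ tree) y∈ y~p y~z (≢-sym z≢p))

  -- Since a path has at most n vertices, fuel with n ≤ l + fuel suffices to extend R until stuck.
  grow : ∀ fuel {y r₀ l} → r₀ ∈ᵥ vertices P → (R : Walk G A y r₀ (suc l)) → Unique (vertices R) →
         y ∉ᵥ vertices P → n ≤ l + fuel → LeafOffP
  grow zero {l = l} _ R uniq _ n≤l+0 =
    contradiction (≤-trans (n≤1+n (suc l)) (≤-trans R-fits (subst (n ≤_) (+-identityʳ l) n≤l+0))) 1+n≰n
    where
    R-fits : suc (suc l) ≤ n
    R-fits = subst (_ ≤_) (∣⊤∣≡n n) (length≤∣p∣ uniq λ _ → ∈⊤)
  grow (suc fuel) {y} {l = l} r₀∈P R uniq y∉P n≤ with any? (λ z →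
    z ∈? A ×-dec y ~? z ×-dec ¬? (z ∈ᵥ? vertices R) ×-dec ¬? (z ∈ᵥ? vertices P))
  ... | yes (z , z∈ , y~z , z∉R , z∉P) =
    grow fuel r₀∈P (step z∈ (~-sym y~z) R) (∉⇒All≢ z∉R ∷ uniq) z∉P (subst (n ≤_) (+-suc l fuel) n≤)
  ... | no stuck = y , source∈ R , y∉P , stuck⇒leaf r₀∈P R uniq y∉P covered
    where
    covered : ∀ {z} → z ∈ A → y ~ z → z ∈ᵥ vertices R ⊎ z ∈ᵥ vertices P
    covered {z} z∈ y~z with z ∈ᵥ? vertices R | z ∈ᵥ? vertices P
    ... | yes z∈R | _       = inj₁ z∈R
    ... | no  _   | yes z∈P = inj₂ z∈P
    ... | no  z∉R | no z∉P  = contradiction (z , z∈ , y~z , z∉R , z∉P) stuck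

  leaf-off-path : ∀ {x} → x ∈ A → x ∉ᵥ vertices P → LeafOffP
  leaf-off-path x∈ x∉P
    with boundary-edge (_∈ᵥ? vertices P) (proj₂ (proj₁ tree _ _ (source∈ P) x∈)) (source∈vertices P) x∉P
  ... | r₀ , r₁ , r₀∈P , r₁∉P , r₁∈ , r₀~r₁ =
    grow n r₀∈P (step r₁∈ (~-sym r₀~r₁) (here (vertices⊆ P r₀∈P))) uniq r₁∉P ≤-refl
    where
    uniq : Unique (r₁ ∷ r₀ ∷ [])
    uniq = ((λ { refl → r₁∉P r₀∈P }) ∷ []) ∷ [] ∷ []

module Pruning {n} (G : Graph n) where

  open Walks G

  IsEvine⇒2+j+j≤∣A∣ : ∀ {j A} → IsEvine G j A → suc (suc (j + j)) ≤ ∣ A ∣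
  IsEvine⇒2+j+j≤∣A∣ (_ , (_ , _ , _ , _ , dist) , _) = Dist⇒d<∣S∣ dist

  -- A vertex off the diametral path P exists by counting, hence a leaf x off P; deleting x keeps P,
  -- and bypass shortens every other walk into A - x.
  evine-prune-step : ∀ {j A} → IsEvine G j A → suc (suc (suc (j + j))) ≤ ∣ A ∣ →
                     ∃ λ x → x ∈ A × IsEvine G j (A - x)
  evine-prune-step {j} {A} (tree@(connected , acyclic) , (u , v , _ , _ , P , P-min) , bounded) big
    with any? (λ z → z ∈? A ×-dec ¬? (z ∈ᵥ? vertices P))
  ... | no none-off-P = contradiction (∣p∣≤length (vertices P) A on-P) (<⇒≱ big)
    where
    on-P : ∀ {z} → z ∈ A → z ∈ᵥ vertices P
    on-P {z} z∈ = decidable-stable (z ∈ᵥ? vertices P) λ z∉P → none-off-P (z , z∈ , z∉P)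
  ... | yes (_ , x₀∈ , x₀∉P) with LeafSearch.leaf-off-path tree P x₀∈ x₀∉P
  ...   | x , x∈ , x∉P , leaf = x , x∈ , (connected′ , acyclic-⊆ A-x⊆A acyclic) , diameter′ , bounded′
    where
    A-x⊆A : A - x ⊆ A
    A-x⊆A = p─q⊆p A _

    P-avoids-x : ∀ {z} → z ∈ᵥ vertices P → z ∈ A - x
    P-avoids-x z∈P = x∈p∧x≢y⇒x∈p-y (vertices⊆ P z∈P) λ { refl → x∉P z∈P }

    diameter′ : ∃ λ u → ∃ λ v → u ∈ A - x × v ∈ A - x × Dist G (A - x) u v (suc (j + j))
    diameter′ = u , v , P-avoids-x (source∈vertices P) , P-avoids-x (target∈vertices P) ,
                Dist-⊆ A-x⊆A (restrict P P-avoids-x) (P , P-min)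

    shorten : ∀ {a b k} → a ∈ A - x → b ∈ A - x → Walk G A a b k →
              ∃ λ k′ → k′ ≤ k × Walk G (A - x) a b k′
    shorten a∈ b∈ = bypass leaf (x∈p-y⇒x≢y a∈) (x∈p-y⇒x≢y b∈)

    connected′ : Connected G (A - x)
    connected′ a b a∈ b∈ =
      let k′ , _ , q = shorten a∈ b∈ (proj₂ (connected a b (A-x⊆A a∈) (A-x⊆A b∈))) in k′ , q

    bounded′ : ∀ a b → a ∈ A - x → b ∈ A - x → ∃ λ k → k ≤ suc (j + j) × Walk G (A - x) a b k
    bounded′ a b a∈ b∈ =
      let k , k≤ , p      = bounded a b (A-x⊆A a∈) (A-x⊆A b∈)
          k′ , k′≤k , q = shorten a∈ b∈ p
      in k′ , ≤-trans k′≤k k≤ , q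

  evine-shrink : ∀ {j m A} → IsEvine G j A → suc (suc (j + j)) ≤ m → m ≤ ∣ A ∣ →
                 ∃ λ C → IsEvine G j C × ∣ C ∣ ≡ m
  evine-shrink {j} {m} {A} evine 2+j+j≤m m≤∣A∣ = go (∣ A ∣ ∸ m) evine (sym (m∸n+n≡m m≤∣A∣))
    where
    go : ∀ excess {A} → IsEvine G j A → ∣ A ∣ ≡ excess + m → ∃ λ C → IsEvine G j C × ∣ C ∣ ≡ m
    go zero         evine ∣A∣≡m = _ , evine , ∣A∣≡m
    go (suc excess) evine ∣A∣≡  with evine-prune-step {j} evine
      (≤-trans (s≤s 2+j+j≤m) (≤-trans (s≤s (m≤n+m m excess)) (≤-reflexive (sym ∣A∣≡))))
    ... | x , x∈ , evine′ = go excess evine′ (suc-injective (trans (sym (∣p∣≡1+∣p-x∣ x∈)) ∣A∣≡))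

record _[_]≅_[_] {n} (G : Graph n) (S : Subset n) (H : Graph n) (S′ : Subset n) : Set where
  field
    to      : Fin n → Fin n
    from    : Fin n → Fin n
    to∈     : ∀ {x} → x ∈ S → to x ∈ S′
    from∈   : ∀ {y} → y ∈ S′ → from y ∈ S
    from∘to : ∀ {x} → x ∈ S → from (to x) ≡ x
    to∘from : ∀ {y} → y ∈ S′ → to (from y) ≡ y
    adj-to  : ∀ {x y} → x ∈ S → y ∈ S → adj H (to x) (to y) ≡ adj G x y

module _ {n} {G H : Graph n} where

  open _[_]≅_[_]

  ≅-sym : ∀ {S S′} → G [ S ]≅ H [ S′ ] → H [ S′ ]≅ G [ S ]
  ≅-sym I = record
    { to = from I ; from = to I ; to∈ = from∈ I ; from∈ = to∈ I
    ; from∘to = to∘from I ; to∘from = from∘to I ; adj-to = adj-from }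
    where
    adj-from : ∀ {x y} → x ∈ _ → y ∈ _ → adj G (from I x) (from I y) ≡ adj H x y
    adj-from {x} {y} x∈ y∈ = begin
      adj G (from I x) (from I y)                 ≡⟨ adj-to I (from∈ I x∈) (from∈ I y∈) ⟨
      adj H (to I (from I x)) (to I (from I y))   ≡⟨ cong₂ (adj H) (to∘from I x∈) (to∘from I y∈) ⟩
      adj H x y                                   ∎

  -- The identity outside S: walks can then be mapped without carrying membership proofs.
  totalise : ∀ {S S′ : Subset n} → (Vtx S → Vtx S′) → Fin n → Fin n
  totalise {S} g x with x ∈? S
  ... | yes x∈ = proj₁ (g (x , x∈))
  ... | no  _  = x

  totalise-∈ : ∀ {S S′ : Subset n} (g : Vtx S → Vtx S′) {x} (x∈ : x ∈ S) →
               totalise g x ≡ proj₁ (g (x , x∈))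
  totalise-∈ {S} g {x} x∈ with x ∈? S
  ... | yes x∈′ = cong (λ x∈ → proj₁ (g (x , x∈))) (∈-irrelevant x∈′ x∈)
  ... | no  x∉  = contradiction x∈ x∉

  totalise-inverse : ∀ {S S′ : Subset n} (g : Vtx S → Vtx S′) (h : Vtx S′ → Vtx S) {x} (x∈ : x ∈ S) →
                     h (g (x , x∈)) ≡ (x , x∈) → totalise h (totalise g x) ≡ x
  totalise-inverse g h {x} x∈ h∘g≡id = begin
    totalise h (totalise g x)         ≡⟨ cong (totalise h) (totalise-∈ g x∈) ⟩
    totalise h (proj₁ (g (x , x∈)))   ≡⟨ totalise-∈ h (proj₂ (g (x , x∈))) ⟩
    proj₁ (h (g (x , x∈)))            ≡⟨ cong proj₁ h∘g≡id ⟩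
    x                                 ∎

  fromInducedIso : ∀ {S S′} → InducedIso G S H S′ → G [ S ]≅ H [ S′ ]
  fromInducedIso {S} {S′} (f , adj-pres) = record
    { to      = totalise (Inverse.to f)
    ; from    = totalise (Inverse.from f)
    ; to∈     = λ x∈ → subst (_∈ S′) (sym (totalise-∈ (Inverse.to f) x∈)) (proj₂ (Inverse.to f (_ , x∈)))
    ; from∈   = λ y∈ → subst (_∈ S) (sym (totalise-∈ (Inverse.from f) y∈)) (proj₂ (Inverse.from f (_ , y∈)))
    ; from∘to = λ x∈ → totalise-inverse (Inverse.to f) (Inverse.from f) x∈ (Inverse.strictlyInverseʳ f _)
    ; to∘from = λ y∈ → totalise-inverse (Inverse.from f) (Inverse.to f) y∈ (Inverse.strictlyInverseˡ f _)
    ; adj-to  = λ x∈ y∈ → trans (cong₂ (adj H) (totalise-∈ (Inverse.to f) x∈) (totalise-∈ (Inverse.to f) y∈))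
                                (sym (adj-pres (_ , x∈) (_ , y∈)))
    }

  InImage : ∀ {C C′} → G [ C ]≅ H [ C′ ] → Subset n → Fin n → Set
  InImage {C′ = C′} I S y = y ∈ C′ × from I y ∈ S

  inImage? : ∀ {C C′} (I : G [ C ]≅ H [ C′ ]) (S : Subset n) → Decidable (InImage I S)
  inImage? {C′ = C′} I S y = y ∈? C′ ×-dec from I y ∈? S

  image : ∀ {C C′} → G [ C ]≅ H [ C′ ] → Subset n → Subset n
  image I S = filter (inImage? I S)

  ≅-restrict : ∀ {C C′ S} (I : G [ C ]≅ H [ C′ ]) → S ⊆ C → G [ S ]≅ H [ image I S ]
  ≅-restrict {S = S} I S⊆C = record
    { to      = to I
    ; from    = from I
    ; to∈     = λ x∈ → ∈-filter⁺ (inImage? I S) (to∈ I (S⊆C x∈) , subst (_∈ S) (sym (from∘to I (S⊆C x∈))) x∈)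
    ; from∈   = proj₂ ∘ ∈-filter⁻ (inImage? I S)
    ; from∘to = from∘to I ∘ S⊆C
    ; to∘from = to∘from I ∘ proj₁ ∘ ∈-filter⁻ (inImage? I S)
    ; adj-to  = λ x∈ y∈ → adj-to I (S⊆C x∈) (S⊆C y∈)
    }

module _ {n} {G H : Graph n} {S S′ : Subset n} (I : G [ S ]≅ H [ S′ ]) where

  open _[_]≅_[_] I
  open Walks G using (source∈)

  walk-≅ : ∀ {u v k} → Walk G S u v k → Walk H S′ (to u) (to v) k
  walk-≅ (here u∈)     = here (to∈ u∈)
  walk-≅ (step u∈ e p) = step (to∈ u∈) (trans (adj-to u∈ (source∈ p)) e) (walk-≅ p)

  walk-≅-onto : ∀ {y₁ y₂ k} → y₁ ∈ S′ → y₂ ∈ S′ → Walk G S (from y₁) (from y₂) k → Walk H S′ y₁ y₂ k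
  walk-≅-onto y₁∈ y₂∈ p = subst₂ (λ a b → Walk H S′ a b _) (to∘from y₁∈) (to∘from y₂∈) (walk-≅ p)

  cycle-≅ : Cycle G S → Cycle H S′
  cycle-≅ cycle = record
    { len    = len
    ; c      = to ∘ c
    ; inj    = λ {i} {j} to-cᵢ≡to-cⱼ → inj (begin
                 c i              ≡⟨ from∘to (inS i) ⟨
                 from (to (c i))  ≡⟨ cong from to-cᵢ≡to-cⱼ ⟩
                 from (to (c j))  ≡⟨ from∘to (inS j) ⟩
                 c j              ∎)
    ; inS    = to∈ ∘ inS
    ; consec = λ i → trans (adj-to (inS _) (inS _)) (consec i)
    ; close  = trans (adj-to (inS _) (inS _)) close
    }
    where open Cycle cycle

IsEvine-≅ : ∀ {n} {G H : Graph n} {S S′ j} → G [ S ]≅ H [ S′ ] → IsEvine G j S → IsEvine H j S′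
IsEvine-≅ {S′ = S′} {j} I ((connected , acyclic) , (u , v , u∈ , v∈ , P , P-min) , bounded) =
  (connected′ , acyclic ∘ cycle-≅ (≅-sym I)) ,
  (to u , to v , to∈ u∈ , to∈ v∈ , walk-≅ I P , λ k k<d q → P-min k k<d (walk-≅-onto (≅-sym I) u∈ v∈ q)) ,
  bounded′
  where
  open _[_]≅_[_] I

  connected′ : Connected _ S′
  connected′ y₁ y₂ y₁∈ y₂∈ =
    let k , p = connected (from y₁) (from y₂) (from∈ y₁∈) (from∈ y₂∈) in k , walk-≅-onto I y₁∈ y₂∈ p

  bounded′ : ∀ y₁ y₂ → y₁ ∈ S′ → y₂ ∈ S′ → ∃ λ k → k ≤ suc (j + j) × Walk _ S′ y₁ y₂ k
  bounded′ y₁ y₂ y₁∈ y₂∈ =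
    let k , k≤ , p = bounded (from y₁) (from y₂) (from∈ y₁∈) (from∈ y₂∈) in k , k≤ , walk-≅-onto I y₁∈ y₂∈ p

CardsAppearIn : ∀ {n} → ℕ → Graph n → Graph n → Set
CardsAppearIn {n} m G H = (C : CardIdx n m) → ∃ λ (C′ : CardIdx n m) → G [ proj₁ C ]≅ H [ proj₁ C′ ]

SameDeck⇒CardsAppearIn : ∀ {n m} {G H : Graph n} → SameDeck m G H → CardsAppearIn m G H × CardsAppearIn m H G
SameDeck⇒CardsAppearIn {G = G} {H} (φ , card-iso) = forth , back
  where
  forth : CardsAppearIn _ G H
  forth C = Inverse.to φ C , fromInducedIso (card-iso C)

  back : CardsAppearIn _ H G
  back C′ = C , ≅-sym (subst (λ D → G [ proj₁ C ]≅ H [ proj₁ D ]) (Inverse.strictlyInverseˡ φ C′)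
                             (fromInducedIso (card-iso C)))
    where C = Inverse.from φ C′

module _ {n m} {G H : Graph n} (cards : CardsAppearIn m G H) where

  small-evine-appears : ∀ {j S} → m ≤ n → IsEvine G j S → ∣ S ∣ ≤ m → ∃ λ S′ → IsEvine H j S′
  small-evine-appears {j} {S} m≤n evine ∣S∣≤m with ⊆-extend S ∣S∣≤m m≤n
  ... | C , S⊆C , ∣C∣≡m with cards (C , ∣C∣≡m)
  ...   | _ , I = image I S , IsEvine-≅ {j = j} (≅-restrict I S⊆C) evine

  large-evine-appears : ∀ {j S} → suc (suc (j + j)) ≤ m → IsEvine G j S → m ≤ ∣ S ∣ →
                        ∃ λ S′ → IsEvine H j S′ × ∣ S′ ∣ ≡ m
  large-evine-appears {j} 2+j+j≤m evine m≤∣S∣ with Pruning.evine-shrink G {j} evine 2+j+j≤m m≤∣S∣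
  ... | C , evineC , ∣C∣≡m with cards (C , ∣C∣≡m)
  ...   | (C′ , ∣C′∣≡m) , I = C′ , IsEvine-≅ {j = j} I evineC , ∣C′∣≡m

KCand-transfer : ∀ {n} ℓ {G H : Graph n} {j} → CardsAppearIn (n ∸ ℓ) G H → CardsAppearIn (n ∸ ℓ) H G →
                 KCand ℓ G j → KCand ℓ H j
KCand-transfer {n} ℓ {G} {H} {j} cards cards⁻¹ ((S , evine) , small) =
  small-evine-appears cards {j} (m∸n≤m n ℓ) evine (<⇒≤ (small S evine)) , small′
  where
  small′ : ∀ S′ → IsEvine H j S′ → ∣ S′ ∣ < n ∸ ℓ
  small′ S′ evine′ with ∣ S′ ∣ <? n ∸ ℓ
  ... | yes ∣S′∣<m = ∣S′∣<m
  ... | no  ∣S′∣≮m =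
    let 2+j+j≤m = ≤-trans (Pruning.IsEvine⇒2+j+j≤∣A∣ G {j} evine) (<⇒≤ (small S evine))
        C , evineC , ∣C∣≡m = large-evine-appears cards⁻¹ {j} 2+j+j≤m evine′ (≮⇒≥ ∣S′∣≮m)
    in contradiction (small C evineC) (<-irrefl ∣C∣≡m)

lemma2p7 : (ℓ n : ℕ) → 1 ≤ ℓ → (T T' : Graph n) → IsTree T → IsTree T' →
    SameDeck (n ∸ ℓ) T T' → (j : ℕ) → IsK ℓ T j → IsK ℓ T' j
lemma2p7 ℓ _ _ _ _ _ _ deck j (kT , maximal) =
  KCand-transfer ℓ {j = j} forth back kT , λ j′ kT′ → maximal j′ (KCand-transfer ℓ {j = j′} back forth kT′)
  where
  forth = proj₁ (SameDeck⇒CardsAppearIn deck)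
  back  = proj₂ (SameDeck⇒CardsAppearIn deck)
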